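{- Let $\beta>0$ and let $\mathsf{ALG}$ be a $\beta$-nice algorithm with output size $k'=k$. Let $\{T_1,\dots,T_m\}$ be a random clustering of the ground set $\mathbb N$ into $m$ parts with multiplicity $1$ (i.e., each item is placed, independently, in exactly one of the $m$ parts chosen uniformly at random). Then: (i) if $f$ is a non-negative monotone submodular function, $\mathsf{ALG}$ is a $\frac{1}{2+\beta}$-approximate randomized composable core-set of multiplicity $1$ and size $k$ for $f$ and cardinality constraint $k$, i.e. $\mathbb E[f_k(\mathsf{ALG}(T_1)\cup\dots\cup\mathsf{ALG}(T_m))]\ge \frac{1}{2+\beta}\,\mathbb E[f_k(T_1\cup\dots\cup T_m)]$; (ii) if $f$ is a non-negative (not necessarily monotone) submodular function, $\mathsf{ALG}$ is a $\frac{1-\frac1m}{2+\beta}$-approximate randomized composable core-set of multiplicity $1$ and size $k$ for $f$ and cardinality constraint $k$.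
   Context: $\mathbb N$ is a finite ground set and $f:2^{\mathbb N}\to\mathbb R_{\ge 0}$. $f$ is monotone if $f(X)\le f(Y)$ for $X\subseteq Y$, and submodular if $f(X\cup\{x\})-f(X)\ge f(Y\cup\{x\})-f(Y)$ for all $X\subseteq Y\subseteq\mathbb N$, $x\in\mathbb N\setminus Y$. Write $\Delta(x,X)=f(X\cup\{x\})-f(X)$ and, for an integer $k$, $f_k(S)=\max_{S'\subseteq S,|S'|\le k}f(S')$. A random clustering of $\mathbb N$ into $m$ sets with multiplicity $C$ is a family $\{T_1,\dots,T_m\}$ where each item of $\mathbb N$ is independently assigned to $C$ randomly chosen (distinct) sets among the $m$. An algorithm $\mathsf{ALG}$ that, given any $T\subseteq\mathbb N$, returns $\mathsf{ALG}(T)\subseteq T$ with $|\mathsf{ALG}(T)|\le k'$ is an $\alpha$-approximate randomized composable core-set of size $k'$ and multiplicity $C$ for $f$ and cardinality constraint $k$ if $\mathbb E[f_k(\mathsf{ALG}(T_1)\cup\dots\cup\mathsf{ALG}(T_m))]\ge\alpha\,\mathbb E[f_k(T_1\cup\dots\cup T_m)]$, the expectation over the random clustering. Such an $\mathsf{ALG}$ (output size at most $k'$) is $\beta$-nice for $f$ if for every $T\subseteq\mathbb N$ and every $x\in T\setminus\mathsf{ALG}(T)$: (a) $\mathsf{ALG}(T\setminus\{x\})=\mathsf{ALG}(T)$, and (b) $\Delta(x,\mathsf{ALG}(T))\le\beta\,\frac{f(\mathsf{ALG}(T))}{k'}$.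
   Formalization: The function f takes values in the nonnegative rationals instead of $\mathbb R_{\ge 0}$, and the parameter β ranges over the positive rationals. -}

module Defs where

open import Data.Nat using (ℕ; zero; suc; _≤?_; NonZero)
import Data.Nat as ℕ
open import Data.Integer using (+_)
open import Data.Rational using (ℚ; 0ℚ; _+_; _-_; _*_; _/_; _≤_; _⊔_)
open import Data.Fin using (Fin; _≟_)
open import Data.Fin.Subset using (Subset; inside; outside; _⊆_; _∪_; ⁅_⁆; _∈_; _∉_; ⊥; ⋃; ∣_∣)
open import Data.Vec using (Vec; []; _∷_; lookup; tabulate)
open import Data.List using (List; []; _∷_; map; concatMap; filter; foldr; length)
open import Data.List.Base using (allFin)
import Data.Fin.Subset as Sub
open import Data.Fin.Subset.Properties using (_⊆?_)
open import Relation.Binary.PropositionalEquality using (_≡_)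
open import Data.Bool using (Bool; true; false; if_then_else_)
open import Data.Product using (_×_)
open import Relation.Nullary.Decidable using (⌊_⌋; _×-dec_)

allSubsets : (n : ℕ) → List (Subset n)
allSubsets zero = [] ∷ []
allSubsets (suc n) = concatMap (λ s → (outside ∷ s) ∷ (inside ∷ s) ∷ []) (allSubsets n)

allAssignments : (n m : ℕ) → List (Vec (Fin m) n)
allAssignments zero m = [] ∷ []
allAssignments (suc n) m = concatMap (λ v → map (λ i → i ∷ v) (allFin m)) (allAssignments n m)

sumℚ : List ℚ → ℚ
sumℚ = foldr _+_ 0ℚ

average : List ℚ → ℚ
average [] = 0ℚ
average (x ∷ xs) = sumℚ (x ∷ xs) * (+ 1 / suc (length xs))

-- expectation over the random clustering of Fin n into m parts with multiplicity 1
-- (each item independently placed in exactly one uniformly random part)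
Expect : {n m : ℕ} → (Vec (Fin m) n → ℚ) → ℚ
Expect {n} {m} g = average (map g (allAssignments n m))

part : {n m : ℕ} → Vec (Fin m) n → Fin m → Subset n
part σ i = tabulate (λ x → if ⌊ lookup σ x ≟ i ⌋ then inside else outside)

unionOver : {n m : ℕ} → (Subset n → Subset n) → Vec (Fin m) n → Subset n
unionOver {m = m} A σ = ⋃ (map (λ i → A (part σ i)) (allFin m))

fk : {n : ℕ} → (Subset n → ℚ) → ℕ → Subset n → ℚ
fk {n} f k S = foldr _⊔_ (f ⊥) (map f (filter (λ S' → (S' ⊆? S) ×-dec (∣ S' ∣ ≤? k)) (allSubsets n)))

Δ : {n : ℕ} → (Subset n → ℚ) → Fin n → Subset n → ℚ
Δ f x X = f (X ∪ ⁅ x ⁆) - f X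

NonNegative : {n : ℕ} → (Subset n → ℚ) → Set
NonNegative f = ∀ X → 0ℚ ≤ f X

Monotone : {n : ℕ} → (Subset n → ℚ) → Set
Monotone f = ∀ X Y → X ⊆ Y → f X ≤ f Y

Submodular : {n : ℕ} → (Subset n → ℚ) → Set
Submodular f = ∀ X Y x → X ⊆ Y → x ∉ Y → Δ f x Y ≤ Δ f x X

ValidAlg : {n : ℕ} → ℕ → (Subset n → Subset n) → Set
ValidAlg k' A = ∀ T → A T ⊆ T × ∣ A T ∣ ℕ.≤ k'

Nice : {n : ℕ} → (Subset n → ℚ) → ℚ → (k' : ℕ) → .{{NonZero k'}} → (Subset n → Subset n) → Set
Nice f β k' A = ∀ T x → x ∈ T → x ∉ A T →
  (A (T Sub.- x) ≡ A T) × (Δ f x (A T) ≤ β * (f (A T) * (+ 1 / k')))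

{-# OPTIONS --safe #-}

-- Fix a maximiser O of f among sets of size at most k and, for x ∈ O, let d x be the
-- marginal gain of x on the elements of O after it; submodularity gives d x ≥ 0 and
-- ∑_{x ∈ R} d x ≤ f R for R ⊆ O.  Telescoping f (A_i ∪ O) along O, where A_i = ALG T_i,
-- the gain of x ∈ O is at most β f(A_i)/k if ALG would still reject x after x is moved
-- into T_i (niceness: the output does not change), and at most d x otherwise.  Hence
-- f (A_i ∪ O) ≤ (1 + β) F + ∑_{x ∈ O} [ALG keeps x once moved to T_i] d x, with
-- F = f_k(⋃_i A_i).  Moving x to a uniformly random part preserves the distribution of
-- the clustering, so summing over i the last term has expectation at most
-- m E[∑_{x ∈ O ∩ ⋃A} d x] ≤ m E[F].  On the other side ∑_i f (A_i ∪ O) is at least m f(O)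
-- for monotone f and at least (m - 1) f(O) in general, the A_i being disjoint; and f(O)
-- bounds f_k of the whole ground set.

module Submission where

open import Defs
open import Data.Nat using (ℕ; zero; suc; NonZero; z≤n; s≤s; _≤?_)
import Data.Nat as ℕ
import Data.Nat.Properties as ℕP
open import Data.Integer using (+_)
import Data.Integer as ℤ
import Data.Integer.Properties as ℤP
import Data.Integer.Tactic.RingSolver as ℤSolver
open import Data.Rational
  using (ℚ; 0ℚ; 1ℚ; _+_; _-_; _*_; _/_; _≤_; _<_; _⊔_; -_; toℚᵘ; nonNegative)
import Data.Rational.Properties as ℚP
import Data.Rational.Unnormalised as ℚᵘ
import Data.Rational.Unnormalised.Properties as ℚᵘP
open import Data.Bool using (Bool; true; false; if_then_else_; _∧_; _∨_)
open import Data.Product using (_×_; _,_; proj₁; proj₂)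
open import Data.Sum using (inj₁; inj₂)
open import Relation.Nullary using (yes; no)
open import Relation.Nullary.Negation using (contradiction)
open import Data.List using (List; []; _∷_; map; foldr; filter; concatMap; _++_; length; allFin)
import Data.List.Properties as ListP
open import Relation.Binary.Bundles using (DecTotalOrder)
import Data.Fin.Properties as FinP
open import Data.List.Membership.Propositional using () renaming (_∈_ to _∈ₗ_)
import Data.List.Membership.Propositional.Properties as LMP
open import Data.List.Relation.Unary.Any using (here; there)
import Data.List.Relation.Unary.Any as Any
import Data.List.Relation.Unary.All as All
import Data.List.Relation.Unary.All.Properties as AllP
open import Data.List.Extrema (DecTotalOrder.totalOrder ℚP.≤-decTotalOrder) using (argmax; argmax-all; f[xs]≤f[argmax])
open import Data.Fin using (Fin; zero; suc; _≟_)
open import Data.Fin.Subset using (Subset; outside; inside; _⊆_; _∪_; _∩_; ⁅_⁆; _∈_; _∉_; ⊥; ⋃; ∣_∣) renaming (_-_ to _∖_)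
import Data.Fin.Subset.Properties as SubP
open import Data.Vec using (Vec; []; _∷_; lookup; tabulate; _[_]≔_; here; there)
import Data.Vec.Properties as VecP
open import Function using (_∘_; id)
open import Relation.Binary.PropositionalEquality
open import Relation.Nullary.Decidable using (dec⇒maybe; ⌊_⌋; _×-dec_)
open import Tactic.RingSolver using (solve-∀)
open import Tactic.RingSolver.Core.AlmostCommutativeRing using (AlmostCommutativeRing; fromCommutativeRing)

private
  variable
    I : Set
    p q r : ℚ

-- Rational arithmetic

ℚ-ring : AlmostCommutativeRing _ _
ℚ-ring = fromCommutativeRing ℚP.+-*-commutativeRing (λ x → dec⇒maybe (0ℚ ℚP.≟ x))

open ℚP using (≤-refl; ≤-trans; ≤-reflexive; +-mono-≤; +-monoˡ-≤; +-monoʳ-≤)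

0≤+ : 0ℚ ≤ p → 0ℚ ≤ q → 0ℚ ≤ p + q
0≤+ 0≤p 0≤q = ≤-trans (≤-reflexive (sym (ℚP.+-identityʳ 0ℚ))) (+-mono-≤ 0≤p 0≤q)

*-monoˡ-≤-0≤ : 0ℚ ≤ r → p ≤ q → r * p ≤ r * q
*-monoˡ-≤-0≤ {r = r} 0≤r = ℚP.*-monoˡ-≤-nonNeg r {{nonNegative 0≤r}}

0≤* : 0ℚ ≤ p → 0ℚ ≤ q → 0ℚ ≤ p * q
0≤* {p = p} 0≤p 0≤q = ≤-trans (≤-reflexive (sym (ℚP.*-zeroʳ p))) (*-monoˡ-≤-0≤ 0≤p 0≤q)

p≤q+p : 0ℚ ≤ q → p ≤ q + p
p≤q+p {p = p} 0≤q = ≤-trans (≤-reflexive (sym (ℚP.+-identityˡ p))) (+-mono-≤ 0≤q ≤-refl)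

p≤q⇒0≤q-p : p ≤ q → 0ℚ ≤ q - p
p≤q⇒0≤q-p {p = p} p≤q = ≤-trans (≤-reflexive (sym (ℚP.+-inverseʳ p))) (+-mono-≤ p≤q ≤-refl)

0≤1 : 0ℚ ≤ 1ℚ
0≤1 = ℚP.<⇒≤ (ℚP.positive⁻¹ 1ℚ)

infixr 7 [_]·_

[_]·_ : Bool → ℚ → ℚ
[ b ]· q = if b then q else 0ℚ

[]·-0≤ : ∀ b → 0ℚ ≤ q → 0ℚ ≤ [ b ]· q
[]·-0≤ true  0≤q = 0≤q
[]·-0≤ false _   = ≤-refl

[]·-mono-if : ∀ b → (b ≡ true → p ≤ q) → [ b ]· p ≤ [ b ]· q
[]·-mono-if true  p≤q = p≤q refl
[]·-mono-if false _   = ≤-refl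

[]·-distrib-+ : ∀ b p q → [ b ]· (p + q) ≡ [ b ]· p + [ b ]· q
[]·-distrib-+ true  p q = refl
[]·-distrib-+ false p q = sym (ℚP.+-identityʳ 0ℚ)

[]·-[]· : ∀ a b q → [ a ]· [ b ]· q ≡ [ a ∧ b ]· q
[]·-[]· true  b q = refl
[]·-[]· false b q = refl

fromℕ : ℕ → ℚ
fromℕ zero    = 0ℚ
fromℕ (suc l) = 1ℚ + fromℕ l

fromℕ-0≤ : ∀ l → 0ℚ ≤ fromℕ l
fromℕ-0≤ zero    = ≤-refl
fromℕ-0≤ (suc l) = 0≤+ 0≤1 (fromℕ-0≤ l)

fromℕ-mono : ∀ {a b} → a ℕ.≤ b → fromℕ a ≤ fromℕ b
fromℕ-mono {zero} {b} _ = fromℕ-0≤ b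
fromℕ-mono (s≤s a≤b)    = +-mono-≤ (≤-refl {1ℚ}) (fromℕ-mono a≤b)

toℚᵘ-fromℕ : ∀ l → toℚᵘ (fromℕ l) ℚᵘ.≃ ℚᵘ.mkℚᵘ (+ l) 0
toℚᵘ-fromℕ zero    = ℚᵘP.≃-refl
toℚᵘ-fromℕ (suc l) = begin-equality
  toℚᵘ (1ℚ + fromℕ l)           ≃⟨ ℚP.toℚᵘ-homo-+ 1ℚ (fromℕ l) ⟩
  ℚᵘ.1ℚᵘ ℚᵘ.+ toℚᵘ (fromℕ l)    ≃⟨ ℚᵘP.+-congʳ ℚᵘ.1ℚᵘ (toℚᵘ-fromℕ l) ⟩
  ℚᵘ.1ℚᵘ ℚᵘ.+ ℚᵘ.mkℚᵘ (+ l) 0   ≃⟨ ℚᵘ.*≡* (trans (normalise (+ l)) (cong (ℤ._* + 1) (sym (ℤP.pos-+ 1 l)))) ⟩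
  ℚᵘ.mkℚᵘ (+ suc l) 0           ∎
  where
  open ℚᵘP.≤-Reasoning
  normalise : ∀ a → (+ 1 ℤ.* + 1 ℤ.+ a ℤ.* + 1) ℤ.* + 1 ≡ (+ 1 ℤ.+ a) ℤ.* + 1
  normalise = ℤSolver.solve-∀

fromℕ*1/≡1 : ∀ l .{{_ : NonZero l}} → fromℕ l * (+ 1 / l) ≡ 1ℚ
fromℕ*1/≡1 (suc l) = ℚP.toℚᵘ-injective (begin-equality
  toℚᵘ (fromℕ (suc l) * (+ 1 / suc l))                ≃⟨ ℚP.toℚᵘ-homo-* (fromℕ (suc l)) (+ 1 / suc l) ⟩
  toℚᵘ (fromℕ (suc l)) ℚᵘ.* toℚᵘ (+ 1 / suc l)        ≃⟨ ℚᵘP.*-cong (toℚᵘ-fromℕ (suc l))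
                                                           (ℚP.toℚᵘ-fromℚᵘ (ℚᵘ.mkℚᵘ (+ 1) l)) ⟩
  ℚᵘ.mkℚᵘ (+ suc l) 0 ℚᵘ.* ℚᵘ.mkℚᵘ (+ 1) l           ≃⟨ ℚᵘP.*-inverseʳ (ℚᵘ.mkℚᵘ (+ suc l) 0) ⟩
  ℚᵘ.1ℚᵘ                                              ∎)
  where open ℚᵘP.≤-Reasoning

1/-0≤ : ∀ l .{{_ : NonZero l}} → 0ℚ ≤ + 1 / l
1/-0≤ l = ℚP.nonNegative⁻¹ (+ 1 / l) {{ℚP.normalize-nonNeg 1 l}}

*-cancelˡ-≤-fromℕ : ∀ l .{{_ : NonZero l}} → fromℕ l * p ≤ fromℕ l * q → p ≤ q
*-cancelˡ-≤-fromℕ {p = p} {q = q} l lp≤lq =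
  ≤-trans (≤-reflexive (sym (1/l·l·≡ p))) (≤-trans (*-monoˡ-≤-0≤ (1/-0≤ l) lp≤lq) (≤-reflexive (1/l·l·≡ q)))
  where
  reassoc : ∀ a b x → a * (b * x) ≡ (b * a) * x
  reassoc = solve-∀ ℚ-ring
  1/l·l·≡ : ∀ x → + 1 / l * (fromℕ l * x) ≡ x
  1/l·l·≡ x = trans (reassoc (+ 1 / l) (fromℕ l) x) (trans (cong (_* x) (fromℕ*1/≡1 l)) (ℚP.*-identityˡ x))

fromℕ-1-0≤ : ∀ l .{{_ : NonZero l}} → 0ℚ ≤ fromℕ l - 1ℚ
fromℕ-1-0≤ (suc l) = ≤-trans (fromℕ-0≤ l) (≤-reflexive (sym (cancel (fromℕ l))))
  where
  cancel : ∀ a → 1ℚ + a - 1ℚ ≡ a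
  cancel = solve-∀ ℚ-ring

fromℕ*[1-1/]≡fromℕ-1 : ∀ l .{{_ : NonZero l}} → fromℕ l * (1ℚ - + 1 / l) ≡ fromℕ l - 1ℚ
fromℕ*[1-1/]≡fromℕ-1 l = trans (distrib (fromℕ l) (+ 1 / l)) (cong (λ t → fromℕ l - t) (fromℕ*1/≡1 l))
  where
  distrib : ∀ a b → a * (1ℚ - b) ≡ a - a * b
  distrib = solve-∀ ℚ-ring

-- Finite sums

∑ : List I → (I → ℚ) → ℚ
∑ xs g = sumℚ (map g xs)

syntax ∑ xs (λ x → e) = ∑[ x ∈ xs ] e

module _ {A : Set} where

  ∑-cong : ∀ (xs : List A) {g h} → (∀ a → g a ≡ h a) → ∑ xs g ≡ ∑ xs h
  ∑-cong []       _   = refl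
  ∑-cong (x ∷ xs) g≡h = cong₂ _+_ (g≡h x) (∑-cong xs g≡h)

  ∑-mono : ∀ (xs : List A) {g h} → (∀ a → g a ≤ h a) → ∑ xs g ≤ ∑ xs h
  ∑-mono []       _   = ≤-refl
  ∑-mono (x ∷ xs) g≤h = +-mono-≤ (g≤h x) (∑-mono xs g≤h)

  ∑-+ : ∀ (xs : List A) g h → ∑[ a ∈ xs ] (g a + h a) ≡ ∑ xs g + ∑ xs h
  ∑-+ []       g h = sym (ℚP.+-identityʳ 0ℚ)
  ∑-+ (x ∷ xs) g h =
    trans (cong (λ t → g x + h x + t) (∑-+ xs g h)) (interchange (g x) (h x) (∑ xs g) (∑ xs h))
    where
    interchange : ∀ a b c d → a + b + (c + d) ≡ a + c + (b + d)
    interchange = solve-∀ ℚ-ring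

  ∑-*ˡ : ∀ (xs : List A) c g → ∑[ a ∈ xs ] (c * g a) ≡ c * ∑ xs g
  ∑-*ˡ []       c g = sym (ℚP.*-zeroʳ c)
  ∑-*ˡ (x ∷ xs) c g =
    trans (cong (λ t → c * g x + t) (∑-*ˡ xs c g)) (sym (ℚP.*-distribˡ-+ c (g x) (∑ xs g)))

  ∑-const : ∀ (xs : List A) c → ∑[ _ ∈ xs ] c ≡ fromℕ (length xs) * c
  ∑-const []       c = sym (ℚP.*-zeroˡ c)
  ∑-const (x ∷ xs) c =
    trans (cong (λ t → c + t) (∑-const xs c)) (factor c (fromℕ (length xs)))
    where
    factor : ∀ c l → c + l * c ≡ (1ℚ + l) * c
    factor = solve-∀ ℚ-ring

  ∑-++ : ∀ (xs ys : List A) g → ∑ (xs ++ ys) g ≡ ∑ xs g + ∑ ys g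
  ∑-++ []       ys g = sym (ℚP.+-identityˡ (∑ ys g))
  ∑-++ (x ∷ xs) ys g = trans (cong (λ t → g x + t) (∑-++ xs ys g)) (sym (ℚP.+-assoc (g x) _ _))

module _ {A B : Set} where

  ∑-map : ∀ (h : A → B) (xs : List A) g → ∑ (map h xs) g ≡ ∑ xs (g ∘ h)
  ∑-map h xs g = cong sumℚ (sym (ListP.map-∘ xs))

  ∑-concatMap : ∀ (F : A → List B) (xs : List A) g → ∑ (concatMap F xs) g ≡ ∑[ a ∈ xs ] ∑ (F a) g
  ∑-concatMap F []       g = refl
  ∑-concatMap F (x ∷ xs) g =
    trans (∑-++ (F x) (concatMap F xs) g) (cong (λ t → ∑ (F x) g + t) (∑-concatMap F xs g))

  ∑-comm : ∀ (xs : List A) (ys : List B) (F : A → B → ℚ) → ∑[ a ∈ xs ] ∑[ b ∈ ys ] F a b ≡ ∑[ b ∈ ys ] ∑[ a ∈ xs ] F a b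
  ∑-comm []       ys F = sym (trans (∑-const ys 0ℚ) (ℚP.*-zeroʳ (fromℕ (length ys))))
  ∑-comm (x ∷ xs) ys F =
    trans (cong (λ t → ∑ ys (F x) + t) (∑-comm xs ys F)) (sym (∑-+ ys (F x) (λ b → ∑[ a ∈ xs ] F a b)))

∑-allFin-suc : ∀ n g → ∑[ i ∈ allFin (suc n) ] g i ≡ g zero + ∑[ i ∈ allFin n ] g (suc i)
∑-allFin-suc n g = cong (λ l → g zero + sumℚ l) (trans (ListP.map-tabulate suc g) (sym (ListP.map-tabulate id (g ∘ suc))))

∑-allFin-const : ∀ n c → ∑[ _ ∈ allFin n ] c ≡ fromℕ n * c
∑-allFin-const n c = trans (∑-const (allFin n) c) (cong (λ l → fromℕ l * c) (ListP.length-tabulate {n = n} id))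

∑-allFin-delta : ∀ n (j : Fin n) g → (∀ i → i ≢ j → g i ≡ 0ℚ) → ∑[ i ∈ allFin n ] g i ≡ g j
∑-allFin-delta (suc n) zero g g≡0 = begin
  ∑[ i ∈ allFin (suc n) ] g i          ≡⟨ ∑-allFin-suc n g ⟩
  g zero + ∑[ i ∈ allFin n ] g (suc i) ≡⟨ cong (λ t → g zero + t) (∑-cong (allFin n) (λ i → g≡0 (suc i) λ ())) ⟩
  g zero + ∑[ _ ∈ allFin n ] 0ℚ        ≡⟨ cong (λ t → g zero + t) (trans (∑-allFin-const n 0ℚ) (ℚP.*-zeroʳ (fromℕ n))) ⟩
  g zero + 0ℚ                          ≡⟨ ℚP.+-identityʳ (g zero) ⟩
  g zero                               ∎
  where open ≡-Reasoning
∑-allFin-delta (suc n) (suc j) g g≡0 = begin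
  ∑[ i ∈ allFin (suc n) ] g i          ≡⟨ ∑-allFin-suc n g ⟩
  g zero + ∑[ i ∈ allFin n ] g (suc i) ≡⟨ cong (λ t → t + ∑[ i ∈ allFin n ] g (suc i)) (g≡0 zero λ ()) ⟩
  0ℚ + ∑[ i ∈ allFin n ] g (suc i)     ≡⟨ ℚP.+-identityˡ _ ⟩
  ∑[ i ∈ allFin n ] g (suc i)          ≡⟨ ∑-allFin-delta n j (λ i → g (suc i))
                                            (λ i i≢j → g≡0 (suc i) (i≢j ∘ FinP.suc-injective)) ⟩
  g (suc j)                            ∎
  where open ≡-Reasoning

∑-allFin-count : ∀ {n} (X : Subset n) c → ∑[ x ∈ allFin n ] ([ lookup X x ]· c) ≡ fromℕ ∣ X ∣ * c
∑-allFin-count []                 c = sym (ℚP.*-zeroˡ c)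
∑-allFin-count {suc n} (b ∷ X) c = begin
  ∑[ x ∈ allFin (suc n) ] ([ lookup (b ∷ X) x ]· c) ≡⟨ ∑-allFin-suc n (λ x → [ lookup (b ∷ X) x ]· c) ⟩
  [ b ]· c + ∑[ x ∈ allFin n ] ([ lookup X x ]· c)  ≡⟨ cong (λ t → [ b ]· c + t) (∑-allFin-count X c) ⟩
  [ b ]· c + fromℕ ∣ X ∣ * c                        ≡⟨ count-head b ⟩
  fromℕ ∣ b ∷ X ∣ * c                               ∎
  where
  open ≡-Reasoning
  count-head : ∀ b → [ b ]· c + fromℕ ∣ X ∣ * c ≡ fromℕ ∣ b ∷ X ∣ * c
  count-head true  = factor c (fromℕ ∣ X ∣)
    where
    factor : ∀ c l → c + l * c ≡ (1ℚ + l) * c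
    factor = solve-∀ ℚ-ring
  count-head false = ℚP.+-identityˡ _

-- Subsets

x∉p∖x : ∀ {n} {p : Subset n} {x} → x ∉ p ∖ x
x∉p∖x {p = _ ∷ _} {suc x} (there x∈p∖x) = x∉p∖x x∈p∖x

module _ {n : ℕ} where

  lookup≡false⇒∉ : ∀ {p : Subset n} {x} → lookup p x ≡ false → x ∉ p
  lookup≡false⇒∉ p[x]≡false x∈p with () ← trans (sym (VecP.[]=⇒lookup x∈p)) p[x]≡false

  ∉⇒lookup≡false : ∀ {p : Subset n} {x} → x ∉ p → lookup p x ≡ false
  ∉⇒lookup≡false {p} {x} x∉p with lookup p x in p[x]≡
  ... | true  = contradiction (VecP.lookup⇒[]= x p p[x]≡) x∉p
  ... | false = refl

  ∉-∪ : ∀ {p q : Subset n} {x} → x ∉ p → x ∉ q → x ∉ p ∪ q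
  ∉-∪ {p} {q} x∉p x∉q x∈p∪q with SubP.x∈p∪q⁻ p q x∈p∪q
  ... | inj₁ x∈p = x∉p x∈p
  ... | inj₂ x∈q = x∉q x∈q

  ∪-mono : ∀ {p p′ q q′ : Subset n} → p ⊆ p′ → q ⊆ q′ → p ∪ q ⊆ p′ ∪ q′
  ∪-mono {p} {p′} {q} {q′} p⊆p′ q⊆q′ y∈p∪q with SubP.x∈p∪q⁻ p q y∈p∪q
  ... | inj₁ y∈p = SubP.p⊆p∪q q′ (p⊆p′ y∈p)
  ... | inj₂ y∈q = SubP.q⊆p∪q p′ q′ (q⊆q′ y∈q)

  ∈-∖⁻ : ∀ {p : Subset n} {x y} → y ∈ p ∖ x → y ∈ p × y ≢ x
  ∈-∖⁻ {p} {x} y∈p∖x = SubP.p─q⊆p p ⁅ x ⁆ y∈p∖x , λ { refl → x∉p∖x y∈p∖x }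

  ∈⇒p∪⁅x⁆≡p : ∀ {p : Subset n} {x} → x ∈ p → p ∪ ⁅ x ⁆ ≡ p
  ∈⇒p∪⁅x⁆≡p {p} {x} x∈p = SubP.⊆-antisym ⊆p (SubP.p⊆p∪q ⁅ x ⁆)
    where
    ⊆p : p ∪ ⁅ x ⁆ ⊆ p
    ⊆p y∈ with SubP.x∈p∪q⁻ p ⁅ x ⁆ y∈
    ... | inj₁ y∈p = y∈p
    ... | inj₂ y∈⁅x⁆ rewrite SubP.x∈⁅y⁆⇒x≡y x y∈⁅x⁆ = x∈p

  ∈⇒p∖x∪⁅x⁆≡p : ∀ {p : Subset n} {x} → x ∈ p → (p ∖ x) ∪ ⁅ x ⁆ ≡ p
  ∈⇒p∖x∪⁅x⁆≡p {p} {x} x∈p = SubP.⊆-antisym ⊆p ⊇p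
    where
    ⊆p : (p ∖ x) ∪ ⁅ x ⁆ ⊆ p
    ⊆p y∈ with SubP.x∈p∪q⁻ (p ∖ x) ⁅ x ⁆ y∈
    ... | inj₁ y∈p∖x = proj₁ (∈-∖⁻ y∈p∖x)
    ... | inj₂ y∈⁅x⁆ rewrite SubP.x∈⁅y⁆⇒x≡y x y∈⁅x⁆ = x∈p
    ⊇p : p ⊆ (p ∖ x) ∪ ⁅ x ⁆
    ⊇p {y} y∈p with y ≟ x
    ... | yes refl = SubP.q⊆p∪q (p ∖ x) ⁅ x ⁆ (SubP.x∈⁅x⁆ x)
    ... | no y≢x   = SubP.p⊆p∪q ⁅ x ⁆ (SubP.x∈p∧x≢y⇒x∈p-y y∈p y≢x)

  ∉⇒p∖x≡p : ∀ {p : Subset n} {x} → x ∉ p → p ∖ x ≡ p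
  ∉⇒p∖x≡p {p} {x} x∉p = SubP.⊆-antisym (SubP.p─q⊆p p ⁅ x ⁆)
    λ y∈p → SubP.x∈p∧x≢y⇒x∈p-y y∈p λ { refl → x∉p y∈p }

after : ∀ {n} → Subset n → Fin n → Subset n
after (_ ∷ p) zero    = outside ∷ p
after (_ ∷ p) (suc x) = outside ∷ after p x

after-⊆ : ∀ {n} {p : Subset n} {x} → after p x ⊆ p
after-⊆ {p = _ ∷ _} {zero}  (there y∈) = there y∈
after-⊆ {p = _ ∷ _} {suc x} (there y∈) = there (after-⊆ y∈)

x∉after : ∀ {n} {p : Subset n} {x} → x ∉ after p x
x∉after {p = _ ∷ _} {suc x} (there x∈) = x∉after x∈

after-mono : ∀ {n} {p q : Subset n} {x} → p ⊆ q → after p x ⊆ after q x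
after-mono {p = _ ∷ _} {_ ∷ _} {zero}  p⊆q (there y∈) = there (SubP.drop-there (p⊆q (there y∈)))
after-mono {p = _ ∷ _} {_ ∷ _} {suc x} p⊆q (there y∈) = there (after-mono (SubP.drop-∷-⊆ p⊆q) y∈)

after⊆p∖x : ∀ {n} {p : Subset n} {x} → after p x ⊆ p ∖ x
after⊆p∖x y∈ = SubP.x∈p∧x≢y⇒x∈p-y (after-⊆ y∈) λ { refl → x∉after y∈ }

-- Submodular functions

module _ {n : ℕ} (f : Subset n → ℚ) where

  Δ-∈ : ∀ {x X} → x ∈ X → Δ f x X ≡ 0ℚ
  Δ-∈ {x} {X} x∈X = trans (cong (λ Y → f Y - f X) (∈⇒p∪⁅x⁆≡p x∈X)) (ℚP.+-inverseʳ (f X))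

private
  p≡q+[p-q] : ∀ p q → p ≡ q + (p - q)
  p≡q+[p-q] = solve-∀ ℚ-ring

  split-head : ∀ {n} (f : Subset (suc n) → ℚ) b o Y →
               f ((b ∨ o) ∷ Y) ≡ f (b ∷ Y) + [ o ]· Δ f zero ((b ∨ false) ∷ Y)
  split-head f true  false Y = sym (ℚP.+-identityʳ _)
  split-head f false false Y = sym (ℚP.+-identityʳ _)
  split-head f true  true  Y = trans (p≡q+[p-q] _ (f (true ∷ Y)))
    (cong (λ Z → f (true ∷ Y) + (f (true ∷ Z) - f (true ∷ Y))) (sym (SubP.∪-identityʳ Y)))
  split-head f false true  Y = trans (p≡q+[p-q] _ (f (false ∷ Y)))
    (cong (λ Z → f (false ∷ Y) + (f (true ∷ Z) - f (false ∷ Y))) (sym (SubP.∪-identityʳ Y)))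

  Δ-tail : ∀ {n} (f : Subset (suc n) → ℚ) b y Z → Δ f (suc y) ((b ∨ false) ∷ Z) ≡ Δ (λ s → f (b ∷ s)) y Z
  Δ-tail f true  y Z = refl
  Δ-tail f false y Z = refl

telescope : ∀ {n} (f : Subset n → ℚ) X O →
            f (X ∪ O) ≡ f X + ∑[ x ∈ allFin n ] ([ lookup O x ]· Δ f x (X ∪ after O x))
telescope f [] [] = sym (ℚP.+-identityʳ (f []))
telescope {suc n} f (b ∷ X) (o ∷ O) = begin
  f ((b ∨ o) ∷ (X ∪ O))                          ≡⟨ split-head f b o (X ∪ O) ⟩
  f (b ∷ (X ∪ O)) + term zero                    ≡⟨ cong (λ t → t + term zero) (telescope (λ s → f (b ∷ s)) X O) ⟩
  f (b ∷ X) + tail + term zero                   ≡⟨ ℚP.+-assoc (f (b ∷ X)) tail (term zero) ⟩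
  f (b ∷ X) + (tail + term zero)                 ≡⟨ cong (λ t → f (b ∷ X) + t) (ℚP.+-comm tail (term zero)) ⟩
  f (b ∷ X) + (term zero + tail)                 ≡⟨ cong (λ t → f (b ∷ X) + (term zero + t)) tail≡ ⟩
  f (b ∷ X) + (term zero + ∑[ y ∈ allFin n ] term (suc y)) ≡⟨ cong (λ t → f (b ∷ X) + t) (sym (∑-allFin-suc n term)) ⟩
  f (b ∷ X) + ∑[ x ∈ allFin (suc n) ] term x     ∎
  where
  open ≡-Reasoning
  term : Fin (suc n) → ℚ
  term x = [ lookup (o ∷ O) x ]· Δ f x ((b ∷ X) ∪ after (o ∷ O) x)
  tail = ∑[ y ∈ allFin n ] ([ lookup O y ]· Δ (λ s → f (b ∷ s)) y (X ∪ after O y))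
  tail≡ : tail ≡ ∑[ y ∈ allFin n ] term (suc y)
  tail≡ = ∑-cong (allFin n) λ y → cong ([ lookup O y ]·_) (sym (Δ-tail f b y (X ∪ after O y)))

module _ {n : ℕ} (f : Subset n → ℚ) (submod : Submodular f) where

  Δ-after-0≤ : ∀ {O x} → x ∈ O → f (O ∖ x) ≤ f O → 0ℚ ≤ Δ f x (after O x)
  Δ-after-0≤ {O} {x} x∈O f[O∖x]≤f[O] = begin
    0ℚ                 ≤⟨ p≤q⇒0≤q-p f[O∖x]≤f[O] ⟩
    f O - f (O ∖ x)    ≡⟨ cong (λ Y → f Y - f (O ∖ x)) (sym (∈⇒p∖x∪⁅x⁆≡p x∈O)) ⟩
    Δ f x (O ∖ x)      ≤⟨ submod (after O x) (O ∖ x) x after⊆p∖x x∉p∖x ⟩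
    Δ f x (after O x)  ∎
    where open ℚP.≤-Reasoning

  ∑-Δ-after≤ : 0ℚ ≤ f ⊥ → ∀ {R O} → R ⊆ O → ∑[ x ∈ allFin n ] ([ lookup R x ]· Δ f x (after O x)) ≤ f R
  ∑-Δ-after≤ 0≤f⊥ {R} {O} R⊆O = begin
    ∑[ x ∈ allFin n ] ([ lookup R x ]· Δ f x (after O x))         ≤⟨ ∑-mono (allFin n) termwise ⟩
    ∑[ x ∈ allFin n ] ([ lookup R x ]· Δ f x (⊥ ∪ after R x))     ≤⟨ p≤q+p 0≤f⊥ ⟩
    f ⊥ + ∑[ x ∈ allFin n ] ([ lookup R x ]· Δ f x (⊥ ∪ after R x)) ≡⟨ telescope f ⊥ R ⟨
    f (⊥ ∪ R)                                                     ≡⟨ cong f (SubP.∪-identityˡ R) ⟩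
    f R                                                           ∎
    where
    open ℚP.≤-Reasoning
    termwise : ∀ x → [ lookup R x ]· Δ f x (after O x) ≤ [ lookup R x ]· Δ f x (⊥ ∪ after R x)
    termwise x with lookup R x
    ... | false = ≤-refl
    ... | true  = submod (⊥ ∪ after R x) (after O x) x
                    (λ y∈ → after-mono R⊆O (subst (_ ∈_) (SubP.∪-identityˡ (after R x)) y∈)) x∉after

⊆-⋃ : ∀ {n} {ps : List (Subset n)} {p} → p ∈ₗ ps → p ⊆ ⋃ ps
⊆-⋃ {ps = p ∷ ps} (here refl)  = SubP.p⊆p∪q (⋃ ps)
⊆-⋃ {ps = q ∷ ps} (there p∈ps) = SubP.q⊆p∪q q (⋃ ps) ∘ ⊆-⋃ p∈ps

-- Random clusterings

module _ {n m : ℕ} where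

  ∈-part⁺ : ∀ (σ : Vec (Fin m) n) {i x} → lookup σ x ≡ i → x ∈ part σ i
  ∈-part⁺ σ {i} {x} σx≡i = VecP.lookup⇒[]= x (part σ i) (trans (VecP.lookup∘tabulate _ x) decide)
    where
    decide : (if ⌊ lookup σ x ≟ i ⌋ then inside else outside) ≡ inside
    decide with lookup σ x ≟ i
    ... | yes _   = refl
    ... | no σx≢i = contradiction σx≡i σx≢i

  ∈-part⁻ : ∀ (σ : Vec (Fin m) n) {i x} → x ∈ part σ i → lookup σ x ≡ i
  ∈-part⁻ σ {i} {x} x∈part with lookup σ x ≟ i in eq
  ... | yes σx≡i = σx≡i
  ... | no _     = contradiction x∈part (lookup≡false⇒∉
    (trans (VecP.lookup∘tabulate _ x) (cong (λ d → if ⌊ d ⌋ then inside else outside) eq)))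

  part-∖-agree : ∀ (σ τ : Vec (Fin m) n) {i x} → (∀ y → y ≢ x → lookup σ y ≡ lookup τ y) → part σ i ∖ x ⊆ part τ i ∖ x
  part-∖-agree σ τ σ≡τ y∈ with ∈-∖⁻ y∈
  ... | y∈part , y≢x = SubP.x∈p∧x≢y⇒x∈p-y (∈-part⁺ τ (trans (sym (σ≡τ _ y≢x)) (∈-part⁻ σ y∈part))) y≢x

  part-update-∖ : ∀ (σ : Vec (Fin m) n) x i j → part (σ [ x ]≔ j) i ∖ x ≡ part σ i ∖ x
  part-update-∖ σ x i j = SubP.⊆-antisym
    (part-∖-agree (σ [ x ]≔ j) σ λ y y≢x → VecP.lookup∘update′ y≢x σ j)
    (part-∖-agree σ (σ [ x ]≔ j) λ y y≢x → sym (VecP.lookup∘update′ y≢x σ j))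

  gather : Vec (Fin m) n → (Fin m → Subset n) → Subset n
  gather σ B = tabulate λ x → lookup (B (lookup σ x)) x

  ∈-gather⁻ : ∀ σ B {x} → x ∈ gather σ B → x ∈ B (lookup σ x)
  ∈-gather⁻ σ B {x} x∈ = VecP.lookup⇒[]= x _ (trans (sym (VecP.lookup∘tabulate _ x)) (VecP.[]=⇒lookup x∈))

  ⊆-gather : ∀ σ B {i} → B i ⊆ part σ i → B i ⊆ gather σ B
  ⊆-gather σ B {i} B⊆part {x} x∈B =
    VecP.lookup⇒[]= x _ (trans (VecP.lookup∘tabulate _ x)
      (trans (cong (λ j → lookup (B j) x) (∈-part⁻ σ (B⊆part x∈B))) (VecP.[]=⇒lookup x∈B)))

  gather-⊆-⋃ : ∀ σ B → gather σ B ⊆ ⋃ (map B (allFin m))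
  gather-⊆-⋃ σ B {x} x∈ = ⊆-⋃ (LMP.∈-map⁺ B (LMP.∈-allFin (lookup σ x))) (∈-gather⁻ σ B x∈)

∑-allAssignments-suc : ∀ n m g →
  ∑[ σ ∈ allAssignments (suc n) m ] g σ ≡ ∑[ σ ∈ allAssignments n m ] ∑[ i ∈ allFin m ] g (i ∷ σ)
∑-allAssignments-suc n m g =
  trans (∑-concatMap _ (allAssignments n m) g) (∑-cong (allAssignments n m) λ σ → ∑-map (_∷ σ) (allFin m) g)

∑-resample : ∀ {n m} (x : Fin n) g →
  ∑[ σ ∈ allAssignments n m ] ∑[ i ∈ allFin m ] g (σ [ x ]≔ i) ≡ fromℕ m * ∑[ σ ∈ allAssignments n m ] g σ
∑-resample {suc n} {m} zero g = begin
  ∑[ σ ∈ allAssignments (suc n) m ] ∑[ i ∈ allFin m ] g (σ [ zero ]≔ i)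
    ≡⟨ ∑-allAssignments-suc n m _ ⟩
  ∑[ σ ∈ allAssignments n m ] ∑[ _ ∈ allFin m ] ∑[ i ∈ allFin m ] g (i ∷ σ)
    ≡⟨ ∑-cong (allAssignments n m) (λ σ → ∑-allFin-const m _) ⟩
  ∑[ σ ∈ allAssignments n m ] (fromℕ m * ∑[ i ∈ allFin m ] g (i ∷ σ))
    ≡⟨ ∑-*ˡ (allAssignments n m) (fromℕ m) _ ⟩
  fromℕ m * ∑[ σ ∈ allAssignments n m ] ∑[ i ∈ allFin m ] g (i ∷ σ)
    ≡⟨ cong (fromℕ m *_) (∑-allAssignments-suc n m g) ⟨
  fromℕ m * ∑[ σ ∈ allAssignments (suc n) m ] g σ ∎
  where open ≡-Reasoning
∑-resample {suc n} {m} (suc y) g = begin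
  ∑[ σ ∈ allAssignments (suc n) m ] ∑[ i ∈ allFin m ] g (σ [ suc y ]≔ i)
    ≡⟨ ∑-allAssignments-suc n m _ ⟩
  ∑[ σ ∈ allAssignments n m ] ∑[ j ∈ allFin m ] ∑[ i ∈ allFin m ] g (j ∷ (σ [ y ]≔ i))
    ≡⟨ ∑-comm (allAssignments n m) (allFin m) _ ⟩
  ∑[ j ∈ allFin m ] ∑[ σ ∈ allAssignments n m ] ∑[ i ∈ allFin m ] g (j ∷ (σ [ y ]≔ i))
    ≡⟨ ∑-cong (allFin m) (λ j → ∑-resample y (λ σ → g (j ∷ σ))) ⟩
  ∑[ j ∈ allFin m ] (fromℕ m * ∑[ σ ∈ allAssignments n m ] g (j ∷ σ))
    ≡⟨ ∑-*ˡ (allFin m) (fromℕ m) _ ⟩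
  fromℕ m * ∑[ j ∈ allFin m ] ∑[ σ ∈ allAssignments n m ] g (j ∷ σ)
    ≡⟨ cong (fromℕ m *_) (∑-comm (allFin m) (allAssignments n m) _) ⟩
  fromℕ m * ∑[ σ ∈ allAssignments n m ] ∑[ j ∈ allFin m ] g (j ∷ σ)
    ≡⟨ cong (fromℕ m *_) (∑-allAssignments-suc n m g) ⟨
  fromℕ m * ∑[ σ ∈ allAssignments (suc n) m ] g σ ∎
  where open ≡-Reasoning

Expect-mono-scaled : ∀ {n m} a c (g h : Vec (Fin m) n → ℚ) →
  a * ∑[ σ ∈ allAssignments n m ] g σ ≤ c * ∑[ σ ∈ allAssignments n m ] h σ →
  a * Expect {n} {m} g ≤ c * Expect {n} {m} h
Expect-mono-scaled {n} {m} a c g h = scaled (allAssignments n m)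
  where
  scaled : ∀ σs → a * ∑ σs g ≤ c * ∑ σs h → a * average (map g σs) ≤ c * average (map h σs)
  scaled []       _ = ≤-reflexive (trans (ℚP.*-zeroʳ a) (sym (ℚP.*-zeroʳ c)))
  scaled (σ ∷ σs) ineq rewrite ListP.length-map g σs | ListP.length-map h σs = begin
    a * (∑ (σ ∷ σs) g * w)   ≡⟨ ℚP.*-assoc a _ w ⟨
    a * ∑ (σ ∷ σs) g * w     ≤⟨ ℚP.*-monoʳ-≤-nonNeg w {{nonNegative (1/-0≤ (suc (length σs)))}} ineq ⟩
    c * ∑ (σ ∷ σs) h * w     ≡⟨ ℚP.*-assoc c _ w ⟩
    c * (∑ (σ ∷ σs) h * w)   ∎
    where
    open ℚP.≤-Reasoning
    w = + 1 / suc (length σs)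

-- Nice algorithms and f_k

module _ {n k : ℕ} .{{_ : NonZero k}} (f : Subset n → ℚ) (β : ℚ) {ALG : Subset n → Subset n}
         (nice : Nice f β k ALG) where

  nice-∖-stable : ∀ T x → x ∉ ALG T → ALG (T ∖ x) ≡ ALG T
  nice-∖-stable T x x∉A with x SubP.∈? T
  ... | yes x∈T = proj₁ (nice T x x∈T x∉A)
  ... | no  x∉T = cong ALG (∉⇒p∖x≡p x∉T)

  nice-move-stable : ∀ {m} (σ : Vec (Fin m) n) x i →
    x ∉ ALG (part σ i) → x ∉ ALG (part (σ [ x ]≔ i) i) → ALG (part (σ [ x ]≔ i) i) ≡ ALG (part σ i)
  nice-move-stable σ x i x∉A x∉A′ = begin
    ALG (part (σ [ x ]≔ i) i)      ≡⟨ nice-∖-stable _ x x∉A′ ⟨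
    ALG (part (σ [ x ]≔ i) i ∖ x)  ≡⟨ cong ALG (part-update-∖ σ x i i) ⟩
    ALG (part σ i ∖ x)             ≡⟨ nice-∖-stable _ x x∉A ⟩
    ALG (part σ i)                 ∎
    where open ≡-Reasoning

∈-allSubsets : ∀ {n} (X : Subset n) → X ∈ₗ allSubsets n
∈-allSubsets []            = here refl
∈-allSubsets (outside ∷ X) = LMP.∈-concatMap⁺ _ (Any.map (λ { refl → here refl }) (∈-allSubsets X))
∈-allSubsets (inside ∷ X)  = LMP.∈-concatMap⁺ _ (Any.map (λ { refl → there (here refl) }) (∈-allSubsets X))

≤-foldr-⊔ : ∀ e {q} qs → q ∈ₗ qs → q ≤ foldr _⊔_ e qs
≤-foldr-⊔ e (q ∷ qs) (here refl)  = ℚP.p≤p⊔q q _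
≤-foldr-⊔ e (q ∷ qs) (there p∈qs) = ≤-trans (≤-foldr-⊔ e qs p∈qs) (ℚP.p≤q⊔p q _)

module _ {n : ℕ} (f : Subset n → ℚ) (k : ℕ) where

  f≤fk : ∀ {S X} → X ⊆ S → ∣ X ∣ ℕ.≤ k → f X ≤ fk f k S
  f≤fk {S} {X} X⊆S ∣X∣≤k =
    ≤-foldr-⊔ (f ⊥) _ (LMP.∈-map⁺ f
      (LMP.∈-filter⁺ (λ Y → (Y SubP.⊆? S) ×-dec (∣ Y ∣ ≤? k)) (∈-allSubsets X) (X⊆S , ∣X∣≤k)))

  fk≤ : ∀ {S c} → f ⊥ ≤ c → (∀ X → ∣ X ∣ ℕ.≤ k → f X ≤ c) → fk f k S ≤ c
  fk≤ {S} {c} f⊥≤c f≤c = ListP.foldr-preservesᵇ {P = _≤ c} ℚP.⊔-lub f⊥≤c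
    (AllP.map⁺ (All.map (λ (_ , ∣X∣≤k) → f≤c _ ∣X∣≤k)
      (AllP.all-filter (λ Y → (Y SubP.⊆? S) ×-dec (∣ Y ∣ ≤? k)) (allSubsets n))))

  ∣⊥∣≤k : ∣ ⊥ {n} ∣ ℕ.≤ k
  ∣⊥∣≤k = subst (ℕ._≤ k) (sym (SubP.∣⊥∣≡0 n)) z≤n

  optimum : Subset n
  optimum = argmax f ⊥ (filter (λ X → ∣ X ∣ ≤? k) (allSubsets n))

  ∣optimum∣≤k : ∣ optimum ∣ ℕ.≤ k
  ∣optimum∣≤k = argmax-all f ∣⊥∣≤k (AllP.all-filter (λ X → ∣ X ∣ ≤? k) (allSubsets n))

  optimum-maximal : ∀ X → ∣ X ∣ ℕ.≤ k → f X ≤ f optimum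
  optimum-maximal X ∣X∣≤k =
    All.lookup (f[xs]≤f[argmax] ⊥ _) (LMP.∈-filter⁺ (λ X → ∣ X ∣ ≤? k) (∈-allSubsets X) ∣X∣≤k)

  fk≤f[optimum] : ∀ S → fk f k S ≤ f optimum
  fk≤f[optimum] S = fk≤ (optimum-maximal ⊥ ∣⊥∣≤k) optimum-maximal

-- The core-set bound

-- B i ⊆ part σ i says that the B i are pairwise disjoint.
module _ {n m : ℕ} (f : Subset n → ℚ) (σ : Vec (Fin m) n) (B : Fin m → Subset n)
         (B⊆part : ∀ i → B i ⊆ part σ i) (O : Subset n) where

  private
    term : Subset n → Fin n → ℚ
    term X x = [ lookup X x ]· Δ f x (O ∪ after X x)

  ∑-f-∪-disjoint≡ : ∑[ i ∈ allFin m ] f (B i ∪ O) ≡ fromℕ m * f O + ∑[ x ∈ allFin n ] term (B (lookup σ x)) x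
  ∑-f-∪-disjoint≡ = begin
    ∑[ i ∈ allFin m ] f (B i ∪ O)
      ≡⟨ ∑-cong (allFin m) (λ i → trans (cong f (SubP.∪-comm (B i) O)) (telescope f O (B i))) ⟩
    ∑[ i ∈ allFin m ] (f O + ∑[ x ∈ allFin n ] term (B i) x)
      ≡⟨ ∑-+ (allFin m) (λ _ → f O) _ ⟩
    ∑[ _ ∈ allFin m ] f O + ∑[ i ∈ allFin m ] ∑[ x ∈ allFin n ] term (B i) x
      ≡⟨ cong₂ _+_ (∑-allFin-const m (f O)) (∑-comm (allFin m) (allFin n) _) ⟩
    fromℕ m * f O + ∑[ x ∈ allFin n ] ∑[ i ∈ allFin m ] term (B i) x
      ≡⟨ cong (λ t → fromℕ m * f O + t) (∑-cong (allFin n) λ x → ∑-allFin-delta m (lookup σ x) _ (other-part x)) ⟩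
    fromℕ m * f O + ∑[ x ∈ allFin n ] term (B (lookup σ x)) x ∎
    where
    open ≡-Reasoning
    other-part : ∀ x i → i ≢ lookup σ x → term (B i) x ≡ 0ℚ
    other-part x i i≢σx = cong (λ b → [ b ]· Δ f x (O ∪ after (B i) x))
      (∉⇒lookup≡false λ x∈Bi → i≢σx (sym (∈-part⁻ σ (B⊆part i x∈Bi))))

  ∑-f-∪-disjoint : NonNegative f → Submodular f → (fromℕ m - 1ℚ) * f O ≤ ∑[ i ∈ allFin m ] f (B i ∪ O)
  ∑-f-∪-disjoint f≥0 submod = begin
    (fromℕ m - 1ℚ) * f O
      ≡⟨ distrib (fromℕ m) (f O) ⟩
    fromℕ m * f O + (0ℚ - f O)
      ≤⟨ +-monoʳ-≤ (fromℕ m * f O) (+-monoˡ-≤ (- f O) (f≥0 (O ∪ G))) ⟩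
    fromℕ m * f O + (f (O ∪ G) - f O)
      ≡⟨ cong (λ t → fromℕ m * f O + (t - f O)) (telescope f O G) ⟩
    fromℕ m * f O + (f O + ∑[ x ∈ allFin n ] term G x - f O)
      ≡⟨ cong (λ t → fromℕ m * f O + t) (cancel (f O) _) ⟩
    fromℕ m * f O + ∑[ x ∈ allFin n ] term G x
      ≤⟨ +-monoʳ-≤ (fromℕ m * f O) (∑-mono (allFin n) termwise) ⟩
    fromℕ m * f O + ∑[ x ∈ allFin n ] term (B (lookup σ x)) x
      ≡⟨ ∑-f-∪-disjoint≡ ⟨
    ∑[ i ∈ allFin m ] f (B i ∪ O) ∎
    where
    open ℚP.≤-Reasoning
    G = gather σ B
    distrib : ∀ a b → (a - 1ℚ) * b ≡ a * b + (0ℚ - b)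
    distrib = solve-∀ ℚ-ring
    cancel : ∀ a b → a + b - a ≡ b
    cancel = solve-∀ ℚ-ring
    termwise : ∀ x → term G x ≤ term (B (lookup σ x)) x
    termwise x rewrite VecP.lookup∘tabulate (λ y → lookup (B (lookup σ y)) y) x
      with lookup (B (lookup σ x)) x | x SubP.∈? O
    ... | false | _       = ≤-refl
    ... | true  | yes x∈O = ≤-reflexive (trans (Δ-∈ f (SubP.p⊆p∪q _ x∈O)) (sym (Δ-∈ f (SubP.p⊆p∪q _ x∈O))))
    ... | true  | no x∉O  = submod (O ∪ after (B (lookup σ x)) x) (O ∪ after G x) x
                              (∪-mono id (after-mono (⊆-gather σ B (B⊆part _)))) (∉-∪ x∉O x∉after)

module Coreset {n m k : ℕ} .{{_ : NonZero m}} .{{_ : NonZero k}} {β : ℚ} (β≥0 : 0ℚ ≤ β)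
  {f : Subset n → ℚ} (f≥0 : NonNegative f) (submod : Submodular f)
  {ALG : Subset n → Subset n} (valid : ValidAlg k ALG) (nice : Nice f β k ALG) where

  Clustering : Set
  Clustering = Vec (Fin m) n

  O : Subset n
  O = optimum f k

  A : Clustering → Fin m → Subset n
  A σ i = ALG (part σ i)

  F : Clustering → ℚ
  F σ = fk f k (unionOver ALG σ)

  d : Fin n → ℚ
  d x = Δ f x (after O x)

  picked : Clustering → Fin m → Fin n → Bool
  picked σ i x = lookup (ALG (part (σ [ x ]≔ i) i)) x

  gain : Clustering → Fin m → ℚ
  gain σ i = ∑[ x ∈ allFin n ] ([ lookup O x ]· [ picked σ i x ]· d x)

  slack : Clustering → Fin m → ℚ
  slack σ i = β * (f (A σ i) * (+ 1 / k))

  slack-0≤ : ∀ σ i → 0ℚ ≤ slack σ i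
  slack-0≤ σ i = 0≤* β≥0 (0≤* (f≥0 _) (1/-0≤ k))

  d-0≤ : ∀ {x} → x ∈ O → 0ℚ ≤ d x
  d-0≤ {x} x∈O = Δ-after-0≤ f submod x∈O
    (optimum-maximal f k (O ∖ x) (ℕP.≤-trans (SubP.∣p─q∣≤∣p∣ O ⁅ x ⁆) (∣optimum∣≤k f k)))

  f[A]≤F : ∀ σ i → f (A σ i) ≤ F σ
  f[A]≤F σ i = f≤fk f k (⊆-⋃ (LMP.∈-map⁺ (A σ) (LMP.∈-allFin i))) (proj₂ (valid (part σ i)))

  Δ-A∪after≤ : ∀ σ i {x} → x ∈ O → Δ f x (A σ i ∪ after O x) ≤ slack σ i + [ picked σ i x ]· d x
  Δ-A∪after≤ σ i {x} x∈O with x SubP.∈? A σ i | picked σ i x in picked≡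
  ... | yes x∈A | b = ≤-trans (≤-reflexive (Δ-∈ f (SubP.p⊆p∪q _ x∈A))) (0≤+ (slack-0≤ σ i) ([]·-0≤ b (d-0≤ x∈O)))
  ... | no x∉A | true = ≤-trans (submod (after O x) (A σ i ∪ after O x) x (SubP.q⊆p∪q _ _) (∉-∪ x∉A x∉after))
                                 (p≤q+p (slack-0≤ σ i))
  ... | no x∉A | false = begin
    Δ f x (A σ i ∪ after O x)  ≤⟨ submod (A σ i) (A σ i ∪ after O x) x (SubP.p⊆p∪q _) (∉-∪ x∉A x∉after) ⟩
    Δ f x (A σ i)              ≤⟨ subst (λ B → Δ f x B ≤ β * (f B * (+ 1 / k))) (nice-move-stable f β nice σ x i x∉A x∉A′)
                                        (proj₂ (nice _ x (∈-part⁺ (σ [ x ]≔ i) (VecP.lookup∘update x σ i)) x∉A′)) ⟩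
    slack σ i                  ≡⟨ ℚP.+-identityʳ _ ⟨
    slack σ i + 0ℚ             ∎
    where
    open ℚP.≤-Reasoning
    x∉A′ = lookup≡false⇒∉ picked≡

  f[A∪O]≤ : ∀ σ i → f (A σ i ∪ O) ≤ (1ℚ + β) * F σ + gain σ i
  f[A∪O]≤ σ i = begin
    f (A σ i ∪ O)
      ≡⟨ telescope f (A σ i) O ⟩
    f (A σ i) + ∑[ x ∈ allFin n ] ([ lookup O x ]· Δ f x (A σ i ∪ after O x))
      ≤⟨ +-monoʳ-≤ (f (A σ i)) (∑-mono (allFin n) λ x →
           []·-mono-if (lookup O x) λ O[x]≡true → Δ-A∪after≤ σ i (VecP.lookup⇒[]= x O O[x]≡true)) ⟩
    f (A σ i) + ∑[ x ∈ allFin n ] ([ lookup O x ]· (slack σ i + [ picked σ i x ]· d x))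
      ≡⟨ cong (λ t → f (A σ i) + t) (trans (∑-cong (allFin n) λ x → []·-distrib-+ (lookup O x) _ _) (∑-+ (allFin n) _ _)) ⟩
    f (A σ i) + (∑[ x ∈ allFin n ] ([ lookup O x ]· slack σ i) + gain σ i)
      ≡⟨ cong (λ t → f (A σ i) + (t + gain σ i)) (∑-allFin-count O (slack σ i)) ⟩
    f (A σ i) + (fromℕ ∣ O ∣ * slack σ i + gain σ i)
      ≤⟨ +-monoʳ-≤ (f (A σ i)) (+-monoˡ-≤ (gain σ i)
           (ℚP.*-monoʳ-≤-nonNeg (slack σ i) {{nonNegative (slack-0≤ σ i)}} (fromℕ-mono (∣optimum∣≤k f k)))) ⟩
    f (A σ i) + (fromℕ k * slack σ i + gain σ i)
      ≡⟨ cong (λ t → f (A σ i) + (t + gain σ i)) k·slack≡ ⟩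
    f (A σ i) + (β * f (A σ i) + gain σ i)
      ≡⟨ collect (f (A σ i)) β (gain σ i) ⟩
    (1ℚ + β) * f (A σ i) + gain σ i
      ≤⟨ +-monoˡ-≤ (gain σ i) (*-monoˡ-≤-0≤ (0≤+ 0≤1 β≥0) (f[A]≤F σ i)) ⟩
    (1ℚ + β) * F σ + gain σ i ∎
    where
    open ℚP.≤-Reasoning
    collect : ∀ a b g → a + (b * a + g) ≡ (1ℚ + b) * a + g
    collect = solve-∀ ℚ-ring
    reassoc : ∀ l b a w → l * (b * (a * w)) ≡ (b * a) * (l * w)
    reassoc = solve-∀ ℚ-ring
    k·slack≡ : fromℕ k * slack σ i ≡ β * f (A σ i)
    k·slack≡ = trans (reassoc (fromℕ k) β (f (A σ i)) (+ 1 / k))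
                 (trans (cong (β * f (A σ i) *_) (fromℕ*1/≡1 k)) (ℚP.*-identityʳ _))

  clusterings : List Clustering
  clusterings = allAssignments n m

  kept : Clustering → Subset n
  kept σ = gather σ (A σ)

  own-gain : Fin n → Clustering → ℚ
  own-gain x σ = [ lookup O x ]· [ lookup (kept σ) x ]· d x

  picked≡kept-moved : ∀ σ i x → picked σ i x ≡ lookup (kept (σ [ x ]≔ i)) x
  picked≡kept-moved σ i x = sym (trans (VecP.lookup∘tabulate _ x)
    (cong (λ j → lookup (A (σ [ x ]≔ i) j) x) (VecP.lookup∘update x σ i)))

  ∑-own-gain≤F : ∀ σ → ∑[ x ∈ allFin n ] own-gain x σ ≤ F σ
  ∑-own-gain≤F σ = begin
    ∑[ x ∈ allFin n ] own-gain x σ                       ≡⟨ ∑-cong (allFin n) O∩kept ⟩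
    ∑[ x ∈ allFin n ] ([ lookup (O ∩ kept σ) x ]· d x)   ≤⟨ ∑-Δ-after≤ f submod (f≥0 ⊥) (SubP.p∩q⊆p O (kept σ)) ⟩
    f (O ∩ kept σ)                                       ≤⟨ f≤fk f k (gather-⊆-⋃ σ (A σ) ∘ SubP.p∩q⊆q O (kept σ))
                                                              (ℕP.≤-trans (SubP.∣p∩q∣≤∣p∣ O (kept σ)) (∣optimum∣≤k f k)) ⟩
    F σ                                                  ∎
    where
    open ℚP.≤-Reasoning
    O∩kept : ∀ x → own-gain x σ ≡ [ lookup (O ∩ kept σ) x ]· d x
    O∩kept x = trans ([]·-[]· (lookup O x) _ (d x)) (cong ([_]· d x) (sym (VecP.lookup-zipWith _∧_ x O (kept σ))))

  ∑-gain≤ : ∑[ σ ∈ clusterings ] ∑[ i ∈ allFin m ] gain σ i ≤ fromℕ m * ∑[ σ ∈ clusterings ] F σ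
  ∑-gain≤ = begin
    ∑[ σ ∈ clusterings ] ∑[ i ∈ allFin m ] gain σ i
      ≡⟨ ∑-cong clusterings (λ σ → ∑-cong (allFin m) λ i → ∑-cong (allFin n) λ x →
           cong (λ b → [ lookup O x ]· [ b ]· d x) (picked≡kept-moved σ i x)) ⟩
    ∑[ σ ∈ clusterings ] ∑[ i ∈ allFin m ] ∑[ x ∈ allFin n ] own-gain x (σ [ x ]≔ i)
      ≡⟨ ∑-cong clusterings (λ σ → ∑-comm (allFin m) (allFin n) _) ⟩
    ∑[ σ ∈ clusterings ] ∑[ x ∈ allFin n ] ∑[ i ∈ allFin m ] own-gain x (σ [ x ]≔ i)
      ≡⟨ ∑-comm clusterings (allFin n) _ ⟩
    ∑[ x ∈ allFin n ] ∑[ σ ∈ clusterings ] ∑[ i ∈ allFin m ] own-gain x (σ [ x ]≔ i)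
      ≡⟨ ∑-cong (allFin n) (λ x → ∑-resample x (own-gain x)) ⟩
    ∑[ x ∈ allFin n ] (fromℕ m * ∑[ σ ∈ clusterings ] own-gain x σ)
      ≡⟨ ∑-*ˡ (allFin n) (fromℕ m) _ ⟩
    fromℕ m * ∑[ x ∈ allFin n ] ∑[ σ ∈ clusterings ] own-gain x σ
      ≡⟨ cong (fromℕ m *_) (∑-comm (allFin n) clusterings _) ⟩
    fromℕ m * ∑[ σ ∈ clusterings ] ∑[ x ∈ allFin n ] own-gain x σ
      ≤⟨ *-monoˡ-≤-0≤ (fromℕ-0≤ m) (∑-mono clusterings ∑-own-gain≤F) ⟩
    fromℕ m * ∑[ σ ∈ clusterings ] F σ ∎
    where open ℚP.≤-Reasoning

  ∑∑f[A∪O]≤ : ∑[ σ ∈ clusterings ] ∑[ i ∈ allFin m ] f (A σ i ∪ O) ≤ fromℕ m * ((+ 2 / 1 + β) * ∑[ σ ∈ clusterings ] F σ)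
  ∑∑f[A∪O]≤ = begin
    ∑[ σ ∈ clusterings ] ∑[ i ∈ allFin m ] f (A σ i ∪ O)
      ≤⟨ ∑-mono clusterings (λ σ → ∑-mono (allFin m) (f[A∪O]≤ σ)) ⟩
    ∑[ σ ∈ clusterings ] ∑[ i ∈ allFin m ] ((1ℚ + β) * F σ + gain σ i)
      ≡⟨ ∑-cong clusterings (λ σ → trans (∑-+ (allFin m) _ (gain σ))
           (cong (λ t → t + ∑ (allFin m) (gain σ)) (∑-allFin-const m _))) ⟩
    ∑[ σ ∈ clusterings ] (fromℕ m * ((1ℚ + β) * F σ) + ∑[ i ∈ allFin m ] gain σ i)
      ≡⟨ ∑-+ clusterings _ _ ⟩
    ∑[ σ ∈ clusterings ] (fromℕ m * ((1ℚ + β) * F σ)) + ∑[ σ ∈ clusterings ] ∑[ i ∈ allFin m ] gain σ i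
      ≤⟨ +-mono-≤ (≤-reflexive (trans (∑-*ˡ clusterings (fromℕ m) _)
                     (cong (fromℕ m *_) (∑-*ˡ clusterings (1ℚ + β) F)))) ∑-gain≤ ⟩
    fromℕ m * ((1ℚ + β) * ∑[ σ ∈ clusterings ] F σ) + fromℕ m * ∑[ σ ∈ clusterings ] F σ
      ≡⟨ collect (fromℕ m) β _ ⟩
    fromℕ m * ((+ 2 / 1 + β) * ∑[ σ ∈ clusterings ] F σ) ∎
    where
    open ℚP.≤-Reasoning
    collect : ∀ a b c → a * ((1ℚ + b) * c) + a * c ≡ a * ((1ℚ + 1ℚ + b) * c)
    collect = solve-∀ ℚ-ring

  U : Clustering → ℚ
  U σ = fk f k (unionOver (λ T → T) σ)

  expected-bound : ∀ c a → fromℕ m * c ≡ a → 0ℚ ≤ a →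
    (∀ σ → a * f O ≤ ∑[ i ∈ allFin m ] f (A σ i ∪ O)) →
    c * Expect {n} {m} U ≤ (+ 2 / 1 + β) * Expect {n} {m} F
  expected-bound c a mc≡a 0≤a lower = Expect-mono-scaled c (+ 2 / 1 + β) U F (*-cancelˡ-≤-fromℕ m (begin
    fromℕ m * (c * ∑[ σ ∈ clusterings ] U σ)               ≡⟨ ℚP.*-assoc (fromℕ m) c _ ⟨
    fromℕ m * c * ∑[ σ ∈ clusterings ] U σ                 ≡⟨ cong (_* ∑ clusterings U) mc≡a ⟩
    a * ∑[ σ ∈ clusterings ] U σ                           ≡⟨ ∑-*ˡ clusterings a U ⟨
    ∑[ σ ∈ clusterings ] (a * U σ)                         ≤⟨ ∑-mono clusterings (λ σ → ≤-trans
                                                                (*-monoˡ-≤-0≤ 0≤a (fk≤f[optimum] f k _)) (lower σ)) ⟩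
    ∑[ σ ∈ clusterings ] ∑[ i ∈ allFin m ] f (A σ i ∪ O)  ≤⟨ ∑∑f[A∪O]≤ ⟩
    fromℕ m * ((+ 2 / 1 + β) * ∑[ σ ∈ clusterings ] F σ)  ∎))
    where open ℚP.≤-Reasoning

  monotone-case : Monotone f → Expect {n} {m} U ≤ (+ 2 / 1 + β) * Expect {n} {m} F
  monotone-case mono = subst (_≤ (+ 2 / 1 + β) * Expect F) (ℚP.*-identityˡ _)
    (expected-bound 1ℚ (fromℕ m) (ℚP.*-identityʳ _) (fromℕ-0≤ m) lower)
    where
    lower : ∀ σ → fromℕ m * f O ≤ ∑[ i ∈ allFin m ] f (A σ i ∪ O)
    lower σ = ≤-trans (≤-reflexive (sym (∑-allFin-const m (f O))))
                (∑-mono (allFin m) (λ i → mono O (A σ i ∪ O) (SubP.q⊆p∪q (A σ i) O)))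

  general-case : (1ℚ - + 1 / m) * Expect {n} {m} U ≤ (+ 2 / 1 + β) * Expect {n} {m} F
  general-case = expected-bound (1ℚ - + 1 / m) (fromℕ m - 1ℚ) (fromℕ*[1-1/]≡fromℕ-1 m) (fromℕ-1-0≤ m)
    λ σ → ∑-f-∪-disjoint f σ (A σ) (λ i → proj₁ (valid (part σ i))) O f≥0 submod

theorem1 : (n m k : ℕ) → .{{_ : NonZero m}} → .{{_ : NonZero k}} →
    (β : ℚ) → 0ℚ < β →
    (f : Subset n → ℚ) → NonNegative f → Submodular f →
    (ALG : Subset n → Subset n) → ValidAlg k ALG → Nice f β k ALG →
    (Monotone f →
      Expect {n} {m} (λ σ → fk f k (unionOver (λ T → T) σ))
        ≤ (+ 2 / 1 + β) * Expect {n} {m} (λ σ → fk f k (unionOver ALG σ)))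
    ×
    ((1ℚ - + 1 / m) * Expect {n} {m} (λ σ → fk f k (unionOver (λ T → T) σ))
        ≤ (+ 2 / 1 + β) * Expect {n} {m} (λ σ → fk f k (unionOver ALG σ)))
theorem1 n m k β 0<β f f≥0 submod ALG valid nice = monotone-case , general-case
  where open Coreset {n} {m} {k} (ℚP.<⇒≤ 0<β) f≥0 submod valid nice
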